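{- Let $e \equiv a_1 x_1 + \dots + a_n x_n$ be a linear expression in integer variables with integer coefficients $a_i > 0$, and let $m_i$ be an integer (the current minimum of $x_i$) for each $i$. Let $M = [x_{i_1} = d_{i_1}, \dots, x_{i_n} = d_{i_n}]$ be the matching produced by the greedy procedure $\mathtt{calculateImprovedMinimum}$ (described in the context) applied to $e$ with lower bounds $m_1,\dots,m_n$, and let $\mathit{min} = \sum_{j=1}^n a_{i_j} d_{i_j}$. Then for every integer $n$-tuple $\mathbf{d} = (d_1,\dots,d_n)$ such that $d_i \ge m_i$ for all $i$ and $d_i \ne d_j$ for all $i \ne j$, we have $\sum_{i=1}^n a_i d_i \ge \mathit{min}$.
   Context: The greedy procedure $\mathtt{calculateImprovedMinimum}$, given $e \equiv a_1x_1+\dots+a_nx_n$ with $a_i>0$ and integer lower bounds $m_i$ for the $x_i$, works as follows. Initially all variables are unassigned, $M$ is the empty sequence, and $d := \min(m_1,\dots,m_n) - 1$. Then $n$ times: let $d$ be the smallest integer strictly greater than the current $d$ for which there exists at least one unassigned variable $x_i$ with $m_i \le d$ (such variables are called the candidates for $d$); among the candidates choose the one with the greatest coefficient $a_i$, breaking ties by choosing the smallest index $i$; mark it assigned and append the assignment $x_i = d$ to $M$. The resulting $M$ assigns pairwise distinct values, listed in increasing order, to all variables, with each $x_i$ receiving a value $\ge m_i$. -}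

module Defs where

open import Data.Nat using (ℕ; zero; suc)
open import Data.Fin using (Fin; toℕ)
open import Data.Integer using (ℤ; _+_; _*_; _-_; _≤_; _<_; _⊓_; 0ℤ; 1ℤ)
open import Data.List using (List; []; _∷_; foldr)
open import Data.List.Membership.Propositional using (_∉_)
open import Data.Product using (_×_; _,_)
open import Data.Sum using (_⊎_)
open import Relation.Binary.PropositionalEquality using (_≡_)
open import Relation.Nullary using (¬_)
import Data.Nat as ℕ

-- min(m_1,...,m_n); only used when n ≥ 1 (for n = 0 the procedure makes no step)
minOf : (n : ℕ) → (Fin (suc n) → ℤ) → ℤ
minOf zero    m = m Fin.zero where import Data.Fin as Fin
minOf (suc n) m = m Fin.zero ⊓ minOf n (λ i → m (Fin.suc i)) where import Data.Fin as Fin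

-- initial value of d : min(m_1,...,m_n) - 1   (irrelevant for n = 0)
initD : (n : ℕ) → (Fin n → ℤ) → ℤ
initD zero    m = 0ℤ
initD (suc n) m = minOf n m - 1ℤ

module Greedy {n : ℕ} (a : Fin n → ℤ) (m : Fin n → ℤ) where

  Candidate : List (Fin n) → ℤ → Fin n → Set
  Candidate A d i = (i ∉ A) × (m i ≤ d)

  -- GreedyFrom d A k M : starting with current value d and assigned set A,
  -- performing k further iterations of the loop produces the sequence M
  -- of assignments (x_i = d), listed as pairs (i , d).
  data GreedyFrom (d : ℤ) (A : List (Fin n)) : ℕ → List (Fin n × ℤ) → Set where
    done : GreedyFrom d A zero []
    step : ∀ {k d' i M} →
           d < d' →
           Candidate A d' i →
           (∀ e → d < e → e < d' → ∀ j → ¬ Candidate A e j) →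
           (∀ j → Candidate A d' j → (a j < a i) ⊎ ((a j ≡ a i) × (toℕ i ℕ.≤ toℕ j))) →
           GreedyFrom d' (i ∷ A) k M →
           GreedyFrom d A (suc k) ((i , d') ∷ M)

  IsGreedyResult : List (Fin n × ℤ) → Set
  IsGreedyResult M = GreedyFrom (initD n m) [] n M

  valueOf : List (Fin n × ℤ) → ℤ
  valueOf = foldr (λ { (i , d) acc → a i * d + acc }) 0ℤ

weightedSum : (n : ℕ) → (Fin n → ℤ) → (Fin n → ℤ) → ℤ
weightedSum zero    a d = 0ℤ
weightedSum (suc n) a d = a Fin.zero * d Fin.zero + weightedSum n (λ i → a (Fin.suc i)) (λ i → d (Fin.suc i))
  where import Data.Fin as Fin

-- Exchange argument. Compare the greedy run with an arbitrary admissible assignment f, and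
-- keep as invariant that the values f gives the still unassigned variables are admissible
-- and all exceed the current d. When the greedy step sets x_i = d', no unassigned variable
-- can have an f-value below d' (it would be a candidate for a smaller value), so f can be
-- changed into an admissible assignment with x_i = d' without increasing the weighted sum
-- over the unassigned variables: if some unassigned x_j already takes the value d', swap
-- the values of x_i and x_j (x_j is a candidate for d' too, so a_j ≤ a_i); otherwise lower
-- x_i to d' (as a_i ≥ 0). Then x_i = d' accounts for the term a_i d' of min, and induction
-- on the remaining steps bounds the rest.
module Submission where

open import Defs
open import Data.Nat using (ℕ)
open import Data.Fin using (Fin)
open import Data.Integer using (ℤ; _≤_; _<_; 0ℤ)
open import Data.List using (List)
open import Data.Product using (_×_)
open import Relation.Binary.PropositionalEquality using (_≡_; _≢_)

open import Data.Bool using (if_then_else_)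
open import Data.Empty using (⊥-elim)
open import Data.Nat using (zero; suc; z≤n)
open import Data.Fin using (zero; suc; _≟_)
open import Data.Fin.Permutation.Components using (transpose; transpose-inverse)
open import Data.Fin.Properties using (punchInᵢ≢i; any?)
open import Data.Integer using (_+_; _*_; _-_; -_; +_; 1ℤ; +≤+; nonNegative)
open import Data.Integer using () renaming (_≟_ to _≟ℤ_)
open import Data.Integer.Properties
  using ( +-0-commutativeMonoid; ≤-refl; ≤-reflexive; ≤-trans; <⇒≤; <-≤-trans; ≮⇒≥; ≤∧≢⇒<
        ; +-mono-≤; +-monoʳ-≤; *-monoˡ-≤-nonNeg; *-zeroˡ; *-zeroʳ; i-j≤i; i≤j⇒0≤j-i
        ; i⊓j≤i; i⊓j≤j; suc[i]≤j⇒i<j; +-assoc; module ≤-Reasoning)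
open import Data.Integer.Tactic.RingSolver using (solve-∀)
open import Data.List using ([]; _∷_)
open import Data.List.Relation.Unary.Any using (here; there)
open import Data.Product using (_,_; ∃; proj₁)
open import Data.Sum using (_⊎_; [_,_])
open import Data.Vec.Functional using (updateAt; removeAt)
open import Data.Vec.Functional.Properties using (updateAt-updates; updateAt-minimal)
open import Function using (_∘_; const)
open import Relation.Nullary using (¬_; Dec; yes; no; does; ¬?)
open import Relation.Nullary.Decidable using (dec-true; dec-false; decidable-stable; _×-dec_)
open import Relation.Binary.PropositionalEquality
  using (refl; sym; trans; cong; cong₂; subst; subst₂; module ≡-Reasoning)

open import Algebra.Properties.CommutativeMonoid.Sum +-0-commutativeMonoid
  using (sum; sum-remove; sum-cong-≗; sum-replicate-zero)

∑-mono-≤ : ∀ {n} {g h : Fin n → ℤ} → (∀ x → g x ≤ h x) → sum g ≤ sum h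
∑-mono-≤ {zero}  g≤h = ≤-refl
∑-mono-≤ {suc n} g≤h = +-mono-≤ (g≤h zero) (∑-mono-≤ (g≤h ∘ suc))

∑-nonneg : ∀ {n} {g : Fin n → ℤ} → (∀ x → 0ℤ ≤ g x) → 0ℤ ≤ sum g
∑-nonneg {n} g≥0 = ≤-trans (≤-reflexive (sym (sum-replicate-zero n))) (∑-mono-≤ g≥0)

∑-const-1 : ∀ n → sum {n} (const 1ℤ) ≡ + n
∑-const-1 zero    = refl
∑-const-1 (suc n) = cong (λ k → 1ℤ + k) (∑-const-1 n)

∑-differ-at : ∀ {n} {g h : Fin n → ℤ} i → (∀ x → x ≢ i → g x ≡ h x) →
              sum h ≡ sum g + (h i - g i)
∑-differ-at {suc n} {g} {h} i g≡h = begin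
  sum h                                   ≡⟨ sum-remove h ⟩
  h i + sum (removeAt h i)                ≡⟨ cong (λ s → h i + s) (sum-cong-≗ λ k → sym (g≡h _ (punchInᵢ≢i i k))) ⟩
  h i + sum (removeAt g i)                ≡⟨ rearrange (g i) (h i) (sum (removeAt g i)) ⟩
  g i + sum (removeAt g i) + (h i - g i)  ≡⟨ cong (_+ (h i - g i)) (sym (sum-remove g)) ⟩
  sum g + (h i - g i)                     ∎
  where
  open ≡-Reasoning
  rearrange : ∀ x y r → y + r ≡ x + r + (y - x)
  rearrange = solve-∀

∑-differ-at₂ : ∀ {n} {g h : Fin n → ℤ} {i j} → i ≢ j → (∀ x → x ≢ i → x ≢ j → g x ≡ h x) →
               sum h ≡ sum g + ((h i - g i) + (h j - g j))
∑-differ-at₂ {g = g} {h} {i} {j} i≢j g≡h = begin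
  sum h                                   ≡⟨ ∑-differ-at j k≡h ⟩
  sum k + (h j - k j)                     ≡⟨ cong (λ s → s + (h j - k j)) (∑-differ-at i g≡k) ⟩
  sum g + (k i - g i) + (h j - k j)       ≡⟨ cong₂ (λ u v → sum g + (u - g i) + (h j - v))
                                                   (updateAt-updates i g) (updateAt-minimal j i g (i≢j ∘ sym)) ⟩
  sum g + (h i - g i) + (h j - g j)       ≡⟨ +-assoc (sum g) _ _ ⟩
  sum g + ((h i - g i) + (h j - g j))     ∎
  where
  open ≡-Reasoning
  k : Fin _ → ℤ
  k = updateAt g i (const (h i))
  g≡k : ∀ x → x ≢ i → g x ≡ k x
  g≡k x x≢i = sym (updateAt-minimal x i g x≢i)
  k≡h : ∀ x → x ≢ j → k x ≡ h x
  k≡h x x≢j with x ≟ i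
  ... | yes refl = updateAt-updates i g
  ... | no x≢i   = trans (updateAt-minimal x i g x≢i) (g≡h x x≢i x≢j)

transpose-fixes : ∀ {n} {i j x : Fin n} → x ≢ i → x ≢ j → transpose i j x ≡ x
transpose-fixes {i = i} {j} {x} x≢i x≢j
  rewrite dec-false (x ≟ i) x≢i | dec-false (x ≟ j) x≢j = refl

transpose-mapsˡ : ∀ {n} (i j : Fin n) → transpose i j i ≡ j
transpose-mapsˡ i j rewrite dec-true (i ≟ i) refl = refl

transpose-mapsʳ : ∀ {n} {i j : Fin n} → i ≢ j → transpose i j j ≡ i
transpose-mapsʳ {i = i} {j} i≢j
  rewrite dec-false (j ≟ i) (i≢j ∘ sym) | dec-true (j ≟ j) refl = refl

transpose-injective : ∀ {n} {i j x y : Fin n} → transpose i j x ≡ transpose i j y → x ≡ y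
transpose-injective {i = i} {j} {x} {y} eq =
  trans (sym (transpose-inverse j i)) (trans (cong (transpose j i) eq) (transpose-inverse j i))

transpose-diagonal : ∀ {n} (i x : Fin n) → transpose i i x ≡ x
transpose-diagonal i x = by-cases (x ≟ i)
  where
  by-cases : Dec (x ≡ i) → transpose i i x ≡ x
  by-cases (yes refl) = transpose-mapsˡ x x
  by-cases (no x≢i)   = transpose-fixes x≢i x≢i

0≤* : ∀ {x y} → 0ℤ ≤ x → 0ℤ ≤ y → 0ℤ ≤ x * y
0≤* {x} 0≤x 0≤y = subst (_≤ x * _) (*-zeroʳ x) (*-monoˡ-≤-nonNeg x {{nonNegative 0≤x}} 0≤y)

∑-transpose-≤ : ∀ {n} (w f : Fin n → ℤ) {i j} → w j ≤ w i → f j ≤ f i →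
                sum (λ x → w x * f (transpose i j x)) ≤ sum (λ x → w x * f x)
∑-transpose-≤ w f {i} {j} wj≤wi fj≤fi with i ≟ j
... | yes refl = ≤-reflexive (sum-cong-≗ λ x → cong (λ y → w x * f y) (transpose-diagonal i x))
... | no i≢j = begin
  sum (λ x → w x * f (τ x))
    ≡⟨ ∑-differ-at₂ i≢j unmoved ⟩
  Σwf + ((w i * f (τ i) - w i * f i) + (w j * f (τ j) - w j * f j))
    ≡⟨ cong₂ (λ u v → Σwf + ((w i * f u - w i * f i) + (w j * f v - w j * f j)))
             (transpose-mapsˡ i j) (transpose-mapsʳ i≢j) ⟩
  Σwf + ((w i * f j - w i * f i) + (w j * f i - w j * f j))
    ≡⟨ cong (λ δ → Σwf + δ) (exchange-gain (w i) (w j) (f i) (f j)) ⟩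
  Σwf - (w i - w j) * (f i - f j)
    ≤⟨ i-j≤i _ _ {{nonNegative (0≤* (i≤j⇒0≤j-i wj≤wi) (i≤j⇒0≤j-i fj≤fi))}} ⟩
  Σwf ∎
  where
  open ≤-Reasoning
  τ : Fin _ → Fin _
  τ = transpose i j
  Σwf : ℤ
  Σwf = sum (λ x → w x * f x)
  unmoved : ∀ x → x ≢ i → x ≢ j → w x * f x ≡ w x * f (τ x)
  unmoved x x≢i x≢j = cong (λ y → w x * f y) (sym (transpose-fixes x≢i x≢j))
  exchange-gain : ∀ wi wj fi fj →
                  (wi * fj - wi * fi) + (wj * fi - wj * fj) ≡ - ((wi - wj) * (fi - fj))
  exchange-gain = solve-∀

∑-lower-≤ : ∀ {n} (w f : Fin n → ℤ) {i v} → 0ℤ ≤ w i → v ≤ f i →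
            sum (λ x → w x * updateAt f i (const v) x) ≤ sum (λ x → w x * f x)
∑-lower-≤ w f {i} {v} 0≤wi v≤fi = ∑-mono-≤ lowered
  where
  lowered : ∀ x → w x * updateAt f i (const v) x ≤ w x * f x
  lowered x with x ≟ i
  ... | yes refl = subst (λ y → w x * y ≤ w x * f x) (sym (updateAt-updates i f))
                         (*-monoˡ-≤-nonNeg (w x) {{nonNegative 0≤wi}} v≤fi)
  ... | no x≢i   = ≤-reflexive (cong (w x *_) (updateAt-minimal x i f x≢i))

module _ {n : ℕ} where
  open import Data.List.Membership.DecPropositional (_≟_ {n}) using (_∈_; _∉_; _∈?_)

  vanishOn : List (Fin n) → (Fin n → ℤ) → Fin n → ℤ
  vanishOn A g x = if does (x ∈? A) then 0ℤ else g x

  vanishOn-∈ : ∀ {A x} g → x ∈ A → vanishOn A g x ≡ 0ℤ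
  vanishOn-∈ {A} {x} g x∈A rewrite dec-true (x ∈? A) x∈A = refl

  vanishOn-∉ : ∀ {A x} g → x ∉ A → vanishOn A g x ≡ g x
  vanishOn-∉ {A} {x} g x∉A rewrite dec-false (x ∈? A) x∉A = refl

  vanishOn-*ʳ : ∀ A (w f : Fin n → ℤ) x → vanishOn A w x * f x ≡ vanishOn A (λ y → w y * f y) x
  vanishOn-*ʳ A w f x = by-cases (x ∈? A)
    where
    open ≡-Reasoning
    by-cases : Dec (x ∈ A) → vanishOn A w x * f x ≡ vanishOn A (λ y → w y * f y) x
    by-cases (yes x∈A) = begin
      vanishOn A w x * f x                 ≡⟨ cong (_* f x) (vanishOn-∈ w x∈A) ⟩
      0ℤ * f x                             ≡⟨ *-zeroˡ (f x) ⟩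
      0ℤ                                   ≡⟨ vanishOn-∈ (λ y → w y * f y) x∈A ⟨
      vanishOn A (λ y → w y * f y) x       ∎
    by-cases (no x∉A)  = trans (cong (_* f x) (vanishOn-∉ w x∉A))
                               (sym (vanishOn-∉ (λ y → w y * f y) x∉A))

  vanishOn-∷-≢ : ∀ {A g i x} → x ≢ i → vanishOn A g x ≡ vanishOn (i ∷ A) g x
  vanishOn-∷-≢ {A} {g} {i} {x} x≢i = by-cases (x ∈? A)
    where
    by-cases : Dec (x ∈ A) → vanishOn A g x ≡ vanishOn (i ∷ A) g x
    by-cases (yes x∈A) = trans (vanishOn-∈ g x∈A) (sym (vanishOn-∈ g (there x∈A)))
    by-cases (no x∉A)  = trans (vanishOn-∉ g x∉A)
                               (sym (vanishOn-∉ {i ∷ A} g λ { (here x≡i) → x≢i x≡i ; (there x∈A) → x∉A x∈A }))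

  ∑-vanishOn-∷ : ∀ {A g i} → i ∉ A → sum (vanishOn A g) ≡ g i + sum (vanishOn (i ∷ A) g)
  ∑-vanishOn-∷ {A} {g} {i} i∉A = begin
    sum old                              ≡⟨ shift (sum old) (g i) ⟩
    g i + (sum old + (0ℤ - g i))         ≡⟨ cong (λ δ → g i + (sum old + δ)) at-i ⟨
    g i + (sum old + (new i - old i))    ≡⟨ cong (λ s → g i + s) (∑-differ-at i λ _ → vanishOn-∷-≢ {A} {g}) ⟨
    g i + sum new                        ∎
    where
    open ≡-Reasoning
    old new : Fin n → ℤ
    old = vanishOn A g
    new = vanishOn (i ∷ A) g
    at-i : new i - old i ≡ 0ℤ - g i
    at-i = cong₂ _-_ (vanishOn-∈ {i ∷ A} g (here refl)) (vanishOn-∉ g i∉A)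
    shift : ∀ s x → s ≡ x + (s + (0ℤ - x))
    shift = solve-∀

minOf-≤ : ∀ n (m : Fin (suc n) → ℤ) i → minOf n m ≤ m i
minOf-≤ zero    m zero    = ≤-refl
minOf-≤ (suc n) m zero    = i⊓j≤i _ _
minOf-≤ (suc n) m (suc i) = ≤-trans (i⊓j≤j _ _) (minOf-≤ n (m ∘ suc) i)

initD-< : ∀ n (m : Fin n → ℤ) i → initD n m < m i
initD-< (suc n) m i = suc[i]≤j⇒i<j (subst (_≤ m i) (sym (1+[x-1] (minOf n m))) (minOf-≤ n m i))
  where
  1+[x-1] : ∀ x → 1ℤ + (x - 1ℤ) ≡ x
  1+[x-1] = solve-∀

weightedSum-≡-∑ : ∀ n (a d : Fin n → ℤ) → weightedSum n a d ≡ sum (λ i → a i * d i)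
weightedSum-≡-∑ zero    a d = refl
weightedSum-≡-∑ (suc n) a d = cong (λ s → a zero * d zero + s) (weightedSum-≡-∑ n (a ∘ suc) (d ∘ suc))

<⊎≡×-⇒≤ : ∀ {x y : ℤ} {P : Set} → x < y ⊎ (x ≡ y × P) → x ≤ y
<⊎≡×-⇒≤ = [ <⇒≤ , ≤-reflexive ∘ proj₁ ]

module GreedyOptimal {n : ℕ} (a m : Fin n → ℤ) where
  open Greedy a m
  open import Data.List.Membership.DecPropositional (_≟_ {n}) using (_∈_; _∉_; _∈?_)

  NoCandidateBetween : List (Fin n) → ℤ → ℤ → Set
  NoCandidateBetween A d d' = ∀ e → d < e → e < d' → ∀ j → ¬ Candidate A e j

  record Feasible (A : List (Fin n)) (d : ℤ) (f : Fin n → ℤ) : Set where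
    field
      respects-min : ∀ {x} → x ∉ A → m x ≤ f x
      exceeds      : ∀ {x} → x ∉ A → d < f x
      injective    : ∀ {x y} → x ∉ A → y ∉ A → f x ≡ f y → x ≡ y

  cost : List (Fin n) → (Fin n → ℤ) → ℤ
  cost A f = sum (λ x → vanishOn A a x * f x)

  #unassigned : List (Fin n) → ℤ
  #unassigned A = sum (vanishOn A (const 1ℤ))

  cost-∷ : ∀ {A i} f → i ∉ A → cost A f ≡ a i * f i + cost (i ∷ A) f
  cost-∷ {A} {i} f i∉A = begin
    cost A f                                  ≡⟨ sum-cong-≗ (vanishOn-*ʳ A a f) ⟩
    sum (vanishOn A af)                       ≡⟨ ∑-vanishOn-∷ i∉A ⟩
    a i * f i + sum (vanishOn (i ∷ A) af)     ≡⟨ cong (λ s → a i * f i + s) (sum-cong-≗ (vanishOn-*ʳ (i ∷ A) a f)) ⟨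
    a i * f i + cost (i ∷ A) f                ∎
    where
    open ≡-Reasoning
    af : Fin n → ℤ
    af x = a x * f x

  all-assigned : ∀ {A} → #unassigned A ≡ 0ℤ → ∀ x → x ∈ A
  all-assigned {A} none x with x ∈? A
  ... | yes x∈A = x∈A
  ... | no x∉A  = ⊥-elim (1≰0 (subst (1ℤ ≤_) (trans (sym (∑-vanishOn-∷ x∉A)) none) 1≤1+rest))
    where
    1≤1+rest : 1ℤ ≤ 1ℤ + #unassigned (x ∷ A)
    1≤1+rest = +-monoʳ-≤ 1ℤ (∑-nonneg λ y → nonneg (y ∈? (x ∷ A)))
      where
      nonneg : ∀ {y} → Dec (y ∈ x ∷ A) → 0ℤ ≤ vanishOn (x ∷ A) (const 1ℤ) y
      nonneg (yes y∈) = ≤-reflexive (sym (vanishOn-∈ (const 1ℤ) y∈))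
      nonneg (no y∉)  = subst (0ℤ ≤_) (sym (vanishOn-∉ (const 1ℤ) y∉)) (+≤+ z≤n)
    1≰0 : ¬ (1ℤ ≤ 0ℤ)
    1≰0 (+≤+ ())

  unassigned-≥ : ∀ {A d d' f} → Feasible A d f → NoCandidateBetween A d d' → ∀ {x} → x ∉ A → d' ≤ f x
  unassigned-≥ {f = f} feasible gap {x} x∉A =
    ≮⇒≥ λ fx<d' → gap (f x) (exceeds x∉A) fx<d' x (x∉A , respects-min x∉A)
    where open Feasible feasible

  feasible-∷ : ∀ {A d d' f i} → Feasible A d f → NoCandidateBetween A d d' → i ∉ A → f i ≡ d' →
               Feasible (i ∷ A) d' f
  feasible-∷ {A} {d} {d'} {f} {i} feasible gap i∉A fi≡d' = record
    { respects-min = respects-min ∘ unassigned-before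
    ; exceeds      = λ x∉ → ≤∧≢⇒< (unassigned-≥ feasible gap (unassigned-before x∉)) (taken x∉)
    ; injective    = λ x∉ y∉ → injective (unassigned-before x∉) (unassigned-before y∉)
    }
    where
    open Feasible feasible
    unassigned-before : ∀ {x} → x ∉ i ∷ A → x ∉ A
    unassigned-before x∉ = x∉ ∘ there
    taken : ∀ {x} → x ∉ i ∷ A → d' ≢ f x
    taken x∉ d'≡fx = x∉ (here (injective (unassigned-before x∉) i∉A (trans (sym d'≡fx) (sym fi≡d'))))

  CheaperFixing : List (Fin n) → ℤ → Fin n → ℤ → (Fin n → ℤ) → Set
  CheaperFixing A d i d' f = ∃ λ f' → Feasible A d f' × f' i ≡ d' × cost A f' ≤ cost A f

  exchange-transpose : ∀ {A d d' f i j} → Feasible A d f → NoCandidateBetween A d d' →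
                       i ∉ A → m i ≤ d' → j ∉ A → f j ≡ d' → a j ≤ a i → CheaperFixing A d i d' f
  exchange-transpose {A} {d} {d'} {f} {i} {j} feasible gap i∉A mi≤d' j∉A fj≡d' aj≤ai =
    f ∘ transpose i j , feasible′ , trans (cong f (transpose-mapsˡ i j)) fj≡d' , cheaper
    where
    open Feasible feasible
    transpose-∉ : ∀ {x} → x ∉ A → transpose i j x ∉ A
    transpose-∉ {x} x∉A τx∈A = x∉A (subst (_∈ A) (sym x≡τx) τx∈A)
      where
      x≡τx : x ≡ transpose i j x
      x≡τx = trans (sym (transpose-inverse j i))
                   (transpose-fixes (λ e → j∉A (subst (_∈ A) e τx∈A)) (λ e → i∉A (subst (_∈ A) e τx∈A)))
    min-at : ∀ {x} → x ∉ A → Dec (x ≡ i) → Dec (x ≡ j) → m x ≤ f (transpose i j x)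
    min-at x∉A (yes refl) _          = ≤-trans mi≤d' (unassigned-≥ feasible gap (transpose-∉ x∉A))
    min-at x∉A (no _)     (yes refl) = ≤-trans (subst (m j ≤_) fj≡d' (respects-min j∉A))
                                               (unassigned-≥ feasible gap (transpose-∉ x∉A))
    min-at x∉A (no x≢i)   (no x≢j)   =
      subst (m _ ≤_) (cong f (sym (transpose-fixes x≢i x≢j))) (respects-min x∉A)
    feasible′ : Feasible A d (f ∘ transpose i j)
    feasible′ = record
      { respects-min = λ {x} x∉A → min-at x∉A (x ≟ i) (x ≟ j)
      ; exceeds      = exceeds ∘ transpose-∉
      ; injective    = λ x∉A y∉A → transpose-injective ∘ injective (transpose-∉ x∉A) (transpose-∉ y∉A)
      }
    cheaper : cost A (f ∘ transpose i j) ≤ cost A f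
    cheaper = ∑-transpose-≤ (vanishOn A a) f
      (subst₂ _≤_ (sym (vanishOn-∉ a j∉A)) (sym (vanishOn-∉ a i∉A)) aj≤ai)
      (subst (_≤ f i) (sym fj≡d') (unassigned-≥ feasible gap i∉A))

  exchange-lower : ∀ {A d d' f i} → 0ℤ ≤ a i → Feasible A d f → NoCandidateBetween A d d' →
                   i ∉ A → m i ≤ d' → d < d' → (∀ {j} → j ∉ A → f j ≢ d') → CheaperFixing A d i d' f
  exchange-lower {A} {d} {d'} {f} {i} 0≤ai feasible gap i∉A mi≤d' d<d' d'-free =
    f′ , feasible′ , updateAt-updates i f , cheaper
    where
    open Feasible feasible
    f′ : Fin n → ℤ
    f′ = updateAt f i (const d')
    unchanged : ∀ {x} → x ≢ i → f′ x ≡ f x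
    unchanged {x} x≢i = updateAt-minimal x i f x≢i
    bound-at : ∀ {x} (P : Fin n → ℤ → Set) → P i d' → (x ∉ A → P x (f x)) → x ∉ A → Dec (x ≡ i) →
               P x (f′ x)
    bound-at P Pd' _  _   (yes refl) = subst (P _) (sym (updateAt-updates i f)) Pd'
    bound-at P _   Pf x∉A (no x≢i)   = subst (P _) (sym (unchanged x≢i)) (Pf x∉A)
    injective-at : ∀ {x y} → x ∉ A → y ∉ A → Dec (x ≡ i) → Dec (y ≡ i) → f′ x ≡ f′ y → x ≡ y
    injective-at _   _   (yes refl) (yes refl) _  = refl
    injective-at _   y∉A (yes refl) (no y≢i)   eq =
      ⊥-elim (d'-free y∉A (trans (sym (unchanged y≢i)) (trans (sym eq) (updateAt-updates i f))))
    injective-at x∉A _   (no x≢i)   (yes refl) eq =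
      ⊥-elim (d'-free x∉A (trans (sym (unchanged x≢i)) (trans eq (updateAt-updates i f))))
    injective-at x∉A y∉A (no x≢i)   (no y≢i)   eq =
      injective x∉A y∉A (trans (sym (unchanged x≢i)) (trans eq (unchanged y≢i)))
    feasible′ : Feasible A d f′
    feasible′ = record
      { respects-min = λ {x} x∉A → bound-at (λ y v → m y ≤ v) mi≤d' respects-min x∉A (x ≟ i)
      ; exceeds      = λ {x} x∉A → bound-at (λ _ v → d < v) d<d' exceeds x∉A (x ≟ i)
      ; injective    = λ {x} {y} x∉A y∉A → injective-at x∉A y∉A (x ≟ i) (y ≟ i)
      }
    cheaper : cost A f′ ≤ cost A f
    cheaper = ∑-lower-≤ (vanishOn A a) f (subst (0ℤ ≤_) (sym (vanishOn-∉ a i∉A)) 0≤ai)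
                        (unassigned-≥ feasible gap i∉A)

  exchange : ∀ {A d d' f i} → 0ℤ ≤ a i → Feasible A d f → NoCandidateBetween A d d' → d < d' →
             Candidate A d' i → (∀ j → Candidate A d' j → a j ≤ a i) → CheaperFixing A d i d' f
  exchange {A} {d} {d'} {f} {i} 0≤ai feasible gap d<d' (i∉A , mi≤d') heaviest
    with any? (λ j → ¬? (j ∈? A) ×-dec (f j ≟ℤ d'))
  ... | yes (j , j∉A , fj≡d') = exchange-transpose feasible gap i∉A mi≤d' j∉A fj≡d'
      (heaviest j (j∉A , subst (m j ≤_) fj≡d' (Feasible.respects-min feasible j∉A)))
  ... | no d'-unused = exchange-lower 0≤ai feasible gap i∉A mi≤d' d<d'
      λ j∉A fj≡d' → d'-unused (_ , j∉A , fj≡d')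

  greedy-optimal : (∀ i → 0ℤ ≤ a i) → ∀ {d A k M} → GreedyFrom d A k M →
                   ∀ {f} → Feasible A d f → #unassigned A ≡ + k → valueOf M ≤ cost A f
  greedy-optimal _ {A = A} done {f} _ none = ∑-nonneg λ x → ≤-reflexive (sym (begin-equality
    vanishOn A a x * f x  ≡⟨ cong (_* f x) (vanishOn-∈ a (all-assigned {A} none x)) ⟩
    0ℤ * f x              ≡⟨ *-zeroˡ (f x) ⟩
    0ℤ                    ∎))
    where open ≤-Reasoning
  greedy-optimal a≥0 {A = A} {suc k} {(i , d') ∷ M} (step d<d' (i∉A , mi≤d') gap best rest) {f}
                 feasible count
    with exchange (a≥0 i) feasible gap d<d' (i∉A , mi≤d') (λ j c → <⊎≡×-⇒≤ (best j c))
  ... | f′ , feasible′ , f′i≡d' , cheaper = begin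
    a i * d' + valueOf M           ≤⟨ +-monoʳ-≤ (a i * d') rest-optimal ⟩
    a i * d' + cost (i ∷ A) f′     ≡⟨ cong (λ v → a i * v + cost (i ∷ A) f′) f′i≡d' ⟨
    a i * f′ i + cost (i ∷ A) f′   ≡⟨ cost-∷ f′ i∉A ⟨
    cost A f′                      ≤⟨ cheaper ⟩
    cost A f                       ∎
    where
    open ≤-Reasoning
    rest-optimal : valueOf M ≤ cost (i ∷ A) f′
    rest-optimal = greedy-optimal a≥0 rest (feasible-∷ feasible′ gap i∉A f′i≡d') count′
      where
      1+c-1 : ∀ c → 1ℤ + c - 1ℤ ≡ c
      1+c-1 = solve-∀
      count′ : #unassigned (i ∷ A) ≡ + k
      count′ = trans (sym (1+c-1 _)) (cong (_- 1ℤ) (trans (sym (∑-vanishOn-∷ i∉A)) count))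

theorem3p2 : (n : ℕ) (a : Fin n → ℤ) (m : Fin n → ℤ) →
    (∀ i → 0ℤ < a i) →
    (M : List (Fin n × ℤ)) → Greedy.IsGreedyResult a m M →
    (d : Fin n → ℤ) →
    (∀ i → m i ≤ d i) →
    (∀ i j → i ≢ j → d i ≢ d j) →
    Greedy.valueOf a m M ≤ weightedSum n a d
theorem3p2 n a m a>0 M greedy d d≥m distinct = begin
  Greedy.valueOf a m M   ≤⟨ greedy-optimal (<⇒≤ ∘ a>0) greedy initial (∑-const-1 n) ⟩
  cost [] d              ≡⟨ weightedSum-≡-∑ n a d ⟨
  weightedSum n a d      ∎
  where
  open ≤-Reasoning
  open GreedyOptimal a m
  initial : Feasible [] (initD n m) d
  initial = record
    { respects-min = λ {x} _ → d≥m x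
    ; exceeds      = λ {x} _ → <-≤-trans (initD-< n m x) (d≥m x)
    ; injective    = λ {x} {y} _ _ dx≡dy → decidable-stable (x ≟ y) (λ x≢y → distinct x y x≢y dx≡dy)
    }
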